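{- For every $n \ge 1$, the map $\phi_n \colon \mathcal{A}^* \to U_n(\mathbb{T})$, $\phi_n(w) = [w_{pq}]_{1 \le p,q \le n}$, is a monoid homomorphism.
   Context: $\mathcal{A} = \{1 < 2 < 3 < \dots\}$ is the natural numbers viewed as an ordered alphabet, $\mathcal{A}^*$ the free monoid on it, with empty word $\varepsilon$. The tropical semiring is $\mathbb{T} = \mathbb{R} \cup \{ -\infty\}$ with $x \oplus y = \max\{x,y\}$ and $x \otimes y = x + y$; $U_n(\mathbb{T})$ is the monoid of $n\times n$ upper-triangular tropical matrices (entries below the diagonal equal $-\infty$) under tropical matrix multiplication. For a nonempty word $w \in \mathcal{A}^+$ and $p,q \in \mathcal{A}$, define $w_{pq}$ to be the maximal length of a (not necessarily contiguous) nondecreasing subsequence of $w$ all of whose entries lie in the interval $[p,q]$ if $p \le q$, and $w_{pq} = -\infty$ if $p > q$. For the empty word, $\varepsilon_{pq} = 0$ if $p = q$ and $\varepsilon_{pq} = -\infty$ otherwise. -}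

module Defs where

open import Data.Nat using (ℕ; zero; suc; _≤_; _<_; _≤?_; _⊔_; _+_)
open import Data.Nat.Properties using (_≟_)
open import Data.Fin using (Fin; toℕ)
open import Data.List using (List; []; _∷_; length; map; foldr; filter; allFin)
open import Data.List.Relation.Unary.All using (All; all?)
open import Data.List.Relation.Unary.Linked using (Linked)
open import Data.List.Relation.Unary.Linked.Properties using ()
open import Data.Product using (Σ; Σ-syntax; _×_; proj₁; _,_)
open import Relation.Nullary using (Dec; yes; no)
open import Relation.Nullary.Decidable using (_×-dec_)
open import Relation.Binary.PropositionalEquality using (_≡_)

Letter : Set
Letter = Σ[ a ∈ ℕ ] 1 ≤ a

val : Letter → ℕ
val = proj₁

Word : Set
Word = List Letter

data Trop : Set where
  -∞  : Trop
  fin : ℕ → Trop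

_⊕_ : Trop → Trop → Trop
-∞    ⊕ y     = y
fin x ⊕ -∞    = fin x
fin x ⊕ fin y = fin (x ⊔ y)

_⊗_ : Trop → Trop → Trop
-∞    ⊗ _     = -∞
fin x ⊗ -∞    = -∞
fin x ⊗ fin y = fin (x + y)

Mat : ℕ → Set
Mat n = Fin n → Fin n → Trop

_⊗ᴹ_ : ∀ {n} → Mat n → Mat n → Mat n
(A ⊗ᴹ B) i j = foldr (λ k acc → (A i k ⊗ B k j) ⊕ acc) -∞ (allFin _)

Iᴹ : ∀ {n} → Mat n
Iᴹ i j with toℕ i ≟ toℕ j
... | yes _ = fin 0
... | no  _ = -∞

UpperTriangular : ∀ {n} → Mat n → Set
UpperTriangular {n} M = (i j : Fin n) → toℕ j < toℕ i → M i j ≡ -∞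

subseqs : {A : Set} → List A → List (List A)
subseqs []       = [] ∷ []
subseqs (x ∷ xs) = let r = subseqs xs in Data.List._++_ (map (x ∷_) r) r

Admissible : ℕ → ℕ → List Letter → Set
Admissible p q s =
  Linked (λ a b → val a ≤ val b) s × All (λ a → p ≤ val a × val a ≤ q) s

linked? : (s : List Letter) → Dec (Linked (λ a b → val a ≤ val b) s)
linked? []           = yes Linked.[]
linked? (x ∷ [])     = yes Linked.[-]
linked? (x ∷ y ∷ s) with val x ≤? val y | linked? (y ∷ s)
... | yes p | yes l = yes (p Linked.∷ l)
... | no ¬p | _     = no λ { (p Linked.∷ _) → ¬p p }
... | _     | no ¬l = no λ { (_ Linked.∷ l) → ¬l l }

admissible? : (p q : ℕ) (s : List Letter) → Dec (Admissible p q s)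
admissible? p q s = linked? s ×-dec all? (λ a → (p ≤? val a) ×-dec (val a ≤? q)) s

-- maximal length of a nondecreasing subsequence of w with entries in [p,q]
-- (the empty subsequence is always admissible, so the maximum is ≥ 0)
maxNondecLen : ℕ → ℕ → Word → ℕ
maxNondecLen p q w =
  foldr _⊔_ 0 (map length (filter (admissible? p q) (subseqs w)))

entry : Word → ℕ → ℕ → Trop
entry w p q with p ≤? q
entry w p q | no _ = -∞
entry [] p q | yes _ with p ≟ q
... | yes _ = fin 0
... | no  _ = -∞
entry (x ∷ w) p q | yes _ = fin (maxNondecLen p q (x ∷ w))

-- φₙ(w) = [w_pq]_{1 ≤ p,q ≤ n}; index i : Fin n stands for letter toℕ i + 1
φ : (n : ℕ) → Word → Mat n
φ n w i j = entry w (suc (toℕ i)) (suc (toℕ j))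

module Submission where

open import Defs
open import Data.Nat using (ℕ; suc; _≤_; _≤?_; _⊔_; _+_; z≤n; s≤s; s≤s⁻¹)
open import Data.Nat.Properties
  using ( _≟_; suc-injective; ≤-refl; ≤-trans; ≤-antisym; <⇒≱; m≤m⊔n; m≤n⊔m; ⊔-lub; ⊔-sel
        ; +-mono-≤; +-identityʳ; module ≤-Reasoning)
open import Data.Fin using (Fin; toℕ; fromℕ<)
import Data.Fin as Fin
open import Data.Fin.Properties using (toℕ-fromℕ<; toℕ<n; toℕ-injective)
open import Data.List using (List; []; _∷_; length; map; foldr; filter; allFin; _++_)
open import Data.List.Properties using (length-++; ++-identityʳ)
open import Data.List.Membership.Propositional using (_∈_)
open import Data.List.Membership.Propositional.Properties
  using (∈-++⁺ˡ; ∈-++⁺ʳ; ∈-++⁻; ∈-map⁺; ∈-map⁻; ∈-filter⁺; ∈-filter⁻; ∈-allFin)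
open import Data.List.Relation.Unary.Any using (here; there)
open import Data.List.Relation.Unary.All as All using (All; []; _∷_)
open import Data.List.Relation.Unary.Linked using (Linked; []; [-]; _∷_)
open import Data.Product using (Σ-syntax; _×_; _,_)
open import Data.Sum using (_⊎_; inj₁; inj₂)
open import Relation.Nullary using (¬_; Dec; yes; no; contradiction)
open import Relation.Binary.PropositionalEquality
  using (_≡_; _≢_; refl; sym; trans; cong; cong₂; subst₂)

-- A nondecreasing subsequence of u ++ v with entries in [p,q] splits as one of u with
-- entries in [p,c] followed by one of v with entries in [c,q], where c is the last
-- entry taken from u (or p if there is none); conversely such pieces concatenate.  Hence for p ≤ q
--   (uv)_pq = max_{p ≤ c ≤ q} (u_pc + v_cq),
-- and the terms with c outside [p,q] are -∞, so this is the tropical matrix product.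
-- The empty word, whose matrix is the identity, is treated separately.

data _≼_ : Trop → Trop → Set where
  -∞≼  : ∀ {t} → -∞ ≼ t
  fin≼ : ∀ {a b} → a ≤ b → fin a ≼ fin b

≼-refl : ∀ {t} → t ≼ t
≼-refl { -∞}   = -∞≼
≼-refl {fin _} = fin≼ ≤-refl

≼-reflexive : ∀ {s t} → s ≡ t → s ≼ t
≼-reflexive refl = ≼-refl

≼-trans : ∀ {s t u} → s ≼ t → t ≼ u → s ≼ u
≼-trans -∞≼       _         = -∞≼
≼-trans (fin≼ a≤b) (fin≼ b≤c) = fin≼ (≤-trans a≤b b≤c)

≼-antisym : ∀ {s t} → s ≼ t → t ≼ s → s ≡ t
≼-antisym -∞≼        -∞≼        = refl
≼-antisym (fin≼ a≤b) (fin≼ b≤a) = cong fin (≤-antisym a≤b b≤a)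

x≼x⊕y : ∀ s t → s ≼ (s ⊕ t)
x≼x⊕y -∞      _       = -∞≼
x≼x⊕y (fin _) -∞      = ≼-refl
x≼x⊕y (fin a) (fin b) = fin≼ (m≤m⊔n a b)

y≼x⊕y : ∀ s t → t ≼ (s ⊕ t)
y≼x⊕y -∞      _       = ≼-refl
y≼x⊕y (fin _) -∞      = -∞≼
y≼x⊕y (fin a) (fin b) = fin≼ (m≤n⊔m a b)

⊕-lub : ∀ {s t u} → s ≼ u → t ≼ u → (s ⊕ t) ≼ u
⊕-lub -∞≼        t≼u        = t≼u
⊕-lub (fin≼ a≤c) -∞≼        = fin≼ a≤c
⊕-lub (fin≼ a≤c) (fin≼ b≤c) = fin≼ (⊔-lub a≤c b≤c)

⊗-mono-≼ : ∀ {s t u v} → s ≼ t → u ≼ v → (s ⊗ u) ≼ (t ⊗ v)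
⊗-mono-≼ -∞≼        _          = -∞≼
⊗-mono-≼ (fin≼ _)   -∞≼        = -∞≼
⊗-mono-≼ (fin≼ a≤b) (fin≼ c≤d) = fin≼ (+-mono-≤ a≤b c≤d)

⊗-zeroʳ : ∀ t → t ⊗ -∞ ≡ -∞
⊗-zeroʳ -∞      = refl
⊗-zeroʳ (fin _) = refl

⊗-identityˡ : ∀ t → fin 0 ⊗ t ≡ t
⊗-identityˡ -∞      = refl
⊗-identityˡ (fin _) = refl

⊗-identityʳ : ∀ t → t ⊗ fin 0 ≡ t
⊗-identityʳ -∞      = refl
⊗-identityʳ (fin a) = cong fin (+-identityʳ a)

⨆ : {A : Set} → (A → Trop) → List A → Trop
⨆ f = foldr (λ k acc → f k ⊕ acc) -∞

⨆-least : ∀ {A : Set} {f : A → Trop} {t} xs → (∀ x → f x ≼ t) → ⨆ f xs ≼ t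
⨆-least []       _   = -∞≼
⨆-least (x ∷ xs) f≼t = ⊕-lub (f≼t x) (⨆-least xs f≼t)

⨆-upper : ∀ {A : Set} {f : A → Trop} {x} {xs} → x ∈ xs → f x ≼ ⨆ f xs
⨆-upper {f = f} {xs = y ∷ _} (here refl) = x≼x⊕y (f y) _
⨆-upper {f = f} {xs = y ∷ _} (there x∈) = ≼-trans (⨆-upper x∈) (y≼x⊕y (f y) _)

⊗ᴹ-≡ : ∀ {n} (A B : Mat n) i j {t} k →
       (∀ k → (A i k ⊗ B k j) ≼ t) → t ≼ (A i k ⊗ B k j) → (A ⊗ᴹ B) i j ≡ t
⊗ᴹ-≡ _ _ _ _ k bounded attained =
  ≼-antisym (⨆-least (allFin _) bounded) (≼-trans attained (⨆-upper (∈-allFin k)))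

Iᴹ-diag : ∀ {n} (i : Fin n) → Iᴹ i i ≡ fin 0
Iᴹ-diag i with toℕ i ≟ toℕ i
... | yes _  = refl
... | no i≢i = contradiction refl i≢i

Iᴹ-≢ : ∀ {n} {i k : Fin n} → i ≢ k → Iᴹ i k ≡ -∞
Iᴹ-≢ {i = i} {k} i≢k with toℕ i ≟ toℕ k
... | yes i≡k = contradiction (toℕ-injective i≡k) i≢k
... | no _    = refl

⊗ᴹ-identityˡ : ∀ {n} {A : Mat n} (B : Mat n) → (∀ i k → A i k ≡ Iᴹ i k) → ∀ i j → (A ⊗ᴹ B) i j ≡ B i j
⊗ᴹ-identityˡ {A = A} B A≡I i j = ⊗ᴹ-≡ A B i j i bounded (≼-reflexive (sym diagonal))
  where
  diagonal : A i i ⊗ B i j ≡ B i j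
  diagonal = trans (cong (_⊗ B i j) (trans (A≡I i i) (Iᴹ-diag i))) (⊗-identityˡ (B i j))
  bounded : ∀ k → (A i k ⊗ B k j) ≼ B i j
  bounded k with i Fin.≟ k
  ... | yes refl = ≼-reflexive diagonal
  ... | no i≢k rewrite A≡I i k | Iᴹ-≢ i≢k = -∞≼

⊗ᴹ-identityʳ : ∀ {n} (A : Mat n) {B : Mat n} → (∀ k j → B k j ≡ Iᴹ k j) → ∀ i j → (A ⊗ᴹ B) i j ≡ A i j
⊗ᴹ-identityʳ A {B} B≡I i j = ⊗ᴹ-≡ A B i j j bounded (≼-reflexive (sym diagonal))
  where
  diagonal : A i j ⊗ B j j ≡ A i j
  diagonal = trans (cong (A i j ⊗_) (trans (B≡I j j) (Iᴹ-diag j))) (⊗-identityʳ (A i j))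
  bounded : ∀ k → (A i k ⊗ B k j) ≼ A i j
  bounded k with k Fin.≟ j
  ... | yes refl = ≼-reflexive diagonal
  ... | no k≢j rewrite B≡I k j | Iᴹ-≢ k≢j | ⊗-zeroʳ (A i k) = -∞≼

foldr-⊔-upper : ∀ {x} xs → x ∈ xs → x ≤ foldr _⊔_ 0 xs
foldr-⊔-upper (y ∷ _)  (here refl) = m≤m⊔n y _
foldr-⊔-upper (y ∷ ys) (there x∈)  = ≤-trans (foldr-⊔-upper ys x∈) (m≤n⊔m y _)

foldr-⊔-attained : ∀ xs → foldr _⊔_ 0 xs ≡ 0 ⊎ foldr _⊔_ 0 xs ∈ xs
foldr-⊔-attained []       = inj₁ refl
foldr-⊔-attained (y ∷ ys) with ⊔-sel y (foldr _⊔_ 0 ys)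
... | inj₁ ≡y rewrite ≡y = inj₂ (here refl)
... | inj₂ ≡m rewrite ≡m with foldr-⊔-attained ys
...   | inj₁ ≡0 = inj₁ ≡0
...   | inj₂ m∈ = inj₂ (there m∈)

-- An inductive form of Admissible lo hi, in which the lower bound moves along the
-- sequence: each entry bounds the next one from below.
data Chain : ℕ → ℕ → Word → Set where
  []   : ∀ {lo hi} → Chain lo hi []
  cons : ∀ {lo hi x s} → lo ≤ val x → val x ≤ hi → Chain (val x) hi s → Chain lo hi (x ∷ s)

Chain-weakenˡ : ∀ {lo lo′ hi s} → lo′ ≤ lo → Chain lo hi s → Chain lo′ hi s
Chain-weakenˡ _      []                  = []
Chain-weakenˡ lo′≤lo (cons lo≤x x≤hi ch) = cons (≤-trans lo′≤lo lo≤x) x≤hi ch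

Chain-++⁺ : ∀ {p c q s₁ s₂} → p ≤ c → c ≤ q → Chain p c s₁ → Chain c q s₂ → Chain p q (s₁ ++ s₂)
Chain-++⁺ p≤c _   []                ch₂ = Chain-weakenˡ p≤c ch₂
Chain-++⁺ _   c≤q (cons p≤x x≤c ch₁) ch₂ = cons p≤x (≤-trans x≤c c≤q) (Chain-++⁺ x≤c c≤q ch₁ ch₂)

Chain-++⁻ : ∀ {p q s₂} s₁ → p ≤ q → Chain p q (s₁ ++ s₂) →
            Σ[ c ∈ ℕ ] p ≤ c × c ≤ q × Chain p c s₁ × Chain c q s₂
Chain-++⁻ {p} []       p≤q ch = p , ≤-refl , p≤q , [] , ch
Chain-++⁻      (_ ∷ s₁) _  (cons p≤x x≤q ch) with Chain-++⁻ s₁ x≤q ch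
... | c , x≤c , c≤q , ch₁ , ch₂ = c , ≤-trans p≤x x≤c , c≤q , cons p≤x x≤c ch₁ , ch₂

Linked⇒Chain : ∀ {lo hi x s} → lo ≤ val x →
               Linked (λ a b → val a ≤ val b) (x ∷ s) → All (λ a → val a ≤ hi) (x ∷ s) →
               Chain lo hi (x ∷ s)
Linked⇒Chain lo≤x [-]       (x≤hi ∷ [])  = cons lo≤x x≤hi []
Linked⇒Chain lo≤x (x≤y ∷ l) (x≤hi ∷ ≤hi) = cons lo≤x x≤hi (Linked⇒Chain x≤y l ≤hi)

Admissible⇒Chain : ∀ {p q} s → Admissible p q s → Chain p q s
Admissible⇒Chain []      _                                   = []
Admissible⇒Chain (_ ∷ _) (linked , in-range@((p≤x , _) ∷ _)) =
  Linked⇒Chain p≤x linked (All.map (λ (_ , a≤q) → a≤q) in-range)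

Chain⇒Linked : ∀ {lo hi s} → Chain lo hi s → Linked (λ a b → val a ≤ val b) s
Chain⇒Linked []                           = []
Chain⇒Linked (cons _ _ [])                = [-]
Chain⇒Linked (cons _ _ ch@(cons x≤y _ _)) = x≤y ∷ Chain⇒Linked ch

Chain⇒All : ∀ {lo hi s} → Chain lo hi s → All (λ a → lo ≤ val a × val a ≤ hi) s
Chain⇒All []                  = []
Chain⇒All (cons lo≤x x≤hi ch) = (lo≤x , x≤hi) ∷ Chain⇒All (Chain-weakenˡ lo≤x ch)

Chain⇒Admissible : ∀ {p q s} → Chain p q s → Admissible p q s
Chain⇒Admissible ch = Chain⇒Linked ch , Chain⇒All ch

[]∈subseqs : ∀ (w : Word) → [] ∈ subseqs w
[]∈subseqs []      = here refl
[]∈subseqs (x ∷ w) = ∈-++⁺ʳ (map (x ∷_) (subseqs w)) ([]∈subseqs w)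

subseqs-++⁺ : ∀ (u v : Word) {s₁ s₂} → s₁ ∈ subseqs u → s₂ ∈ subseqs v → s₁ ++ s₂ ∈ subseqs (u ++ v)
subseqs-++⁺ []      v (here refl) s₂∈ = s₂∈
subseqs-++⁺ (x ∷ u) v s₁∈ s₂∈ with ∈-++⁻ (map (x ∷_) (subseqs u)) s₁∈
... | inj₂ s₁∈u = ∈-++⁺ʳ (map (x ∷_) (subseqs (u ++ v))) (subseqs-++⁺ u v s₁∈u s₂∈)
... | inj₁ x∷t∈ with ∈-map⁻ (x ∷_) x∷t∈
...   | _ , t∈u , refl = ∈-++⁺ˡ (∈-map⁺ (x ∷_) (subseqs-++⁺ u v t∈u s₂∈))

subseqs-++⁻ : ∀ (u v : Word) {s} → s ∈ subseqs (u ++ v) →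
              Σ[ s₁ ∈ Word ] Σ[ s₂ ∈ Word ] s₁ ∈ subseqs u × s₂ ∈ subseqs v × s ≡ s₁ ++ s₂
subseqs-++⁻ []      v s∈ = [] , _ , here refl , s∈ , refl
subseqs-++⁻ (x ∷ u) v s∈ with ∈-++⁻ (map (x ∷_) (subseqs (u ++ v))) s∈
... | inj₂ s∈uv with subseqs-++⁻ u v s∈uv
...   | s₁ , s₂ , s₁∈ , s₂∈ , refl = s₁ , s₂ , ∈-++⁺ʳ (map (x ∷_) (subseqs u)) s₁∈ , s₂∈ , refl
subseqs-++⁻ (x ∷ u) v s∈ | inj₁ x∷t∈ with ∈-map⁻ (x ∷_) x∷t∈
...   | _ , t∈uv , refl with subseqs-++⁻ u v t∈uv
...     | s₁ , s₂ , s₁∈ , s₂∈ , refl = x ∷ s₁ , s₂ , ∈-++⁺ˡ (∈-map⁺ (x ∷_) s₁∈) , s₂∈ , refl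

maxNondecLen-upper : ∀ p q w {s} → s ∈ subseqs w → Chain p q s → length s ≤ maxNondecLen p q w
maxNondecLen-upper p q w s∈ ch =
  foldr-⊔-upper _ (∈-map⁺ length (∈-filter⁺ (admissible? p q) s∈ (Chain⇒Admissible ch)))

maxNondecLen-attained : ∀ p q w →
  Σ[ s ∈ Word ] s ∈ subseqs w × Chain p q s × length s ≡ maxNondecLen p q w
maxNondecLen-attained p q w with foldr-⊔-attained (map length (filter (admissible? p q) (subseqs w)))
... | inj₁ ≡0 = [] , []∈subseqs w , [] , sym ≡0
... | inj₂ m∈ with ∈-map⁻ length m∈
...   | s , s∈ , ≡len with ∈-filter⁻ (admissible? p q) s∈
...     | s∈w , adm = s , s∈w , Admissible⇒Chain s adm , sym ≡len

maxNondecLen-++-≥ : ∀ {p c q} (u v : Word) → p ≤ c → c ≤ q →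
                    maxNondecLen p c u + maxNondecLen c q v ≤ maxNondecLen p q (u ++ v)
maxNondecLen-++-≥ {p} {c} {q} u v p≤c c≤q
  with s₁ , s₁∈ , ch₁ , len₁ ← maxNondecLen-attained p c u
     | s₂ , s₂∈ , ch₂ , len₂ ← maxNondecLen-attained c q v = begin
  maxNondecLen p c u + maxNondecLen c q v ≡⟨ cong₂ _+_ (sym len₁) (sym len₂) ⟩
  length s₁ + length s₂                   ≡⟨ sym (length-++ s₁) ⟩
  length (s₁ ++ s₂)                       ≤⟨ maxNondecLen-upper p q (u ++ v)
                                               (subseqs-++⁺ u v s₁∈ s₂∈) (Chain-++⁺ p≤c c≤q ch₁ ch₂) ⟩
  maxNondecLen p q (u ++ v)               ∎
  where open ≤-Reasoning

maxNondecLen-++-≤ : ∀ {p q} (u v : Word) → p ≤ q →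
  Σ[ c ∈ ℕ ] p ≤ c × c ≤ q × maxNondecLen p q (u ++ v) ≤ maxNondecLen p c u + maxNondecLen c q v
maxNondecLen-++-≤ {p} {q} u v p≤q with maxNondecLen-attained p q (u ++ v)
... | s , s∈ , ch , len with subseqs-++⁻ u v s∈
...   | s₁ , s₂ , s₁∈ , s₂∈ , refl with Chain-++⁻ s₁ p≤q ch
...     | c , p≤c , c≤q , ch₁ , ch₂ = c , p≤c , c≤q , (begin
  maxNondecLen p q (u ++ v)               ≡⟨ sym len ⟩
  length (s₁ ++ s₂)                       ≡⟨ length-++ s₁ ⟩
  length s₁ + length s₂                   ≤⟨ +-mono-≤ (maxNondecLen-upper p c u s₁∈ ch₁)
                                                      (maxNondecLen-upper c q v s₂∈ ch₂) ⟩
  maxNondecLen p c u + maxNondecLen c q v ∎)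
  where open ≤-Reasoning

entry-≰ : ∀ w {p q} → ¬ p ≤ q → entry w p q ≡ -∞
entry-≰ w {p} {q} p≰q with p ≤? q
... | yes p≤q = contradiction p≤q p≰q
... | no _    = refl

entry-∷ : ∀ x w {p q} → p ≤ q → entry (x ∷ w) p q ≡ fin (maxNondecLen p q (x ∷ w))
entry-∷ x w {p} {q} p≤q with p ≤? q
... | yes _   = refl
... | no p≰q  = contradiction p≤q p≰q

entry-≼ : ∀ w p q → entry w p q ≼ fin (maxNondecLen p q w)
entry-≼ w p q with p ≤? q
entry-≼ w       p q | no _ = -∞≼
entry-≼ []      p q | yes _ with p ≟ q
... | yes _ = fin≼ z≤n
... | no _  = -∞≼
entry-≼ (_ ∷ _) p q | yes _ = ≼-refl

entry-[]-diag : ∀ p → entry [] p p ≡ fin 0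
entry-[]-diag p with p ≤? p
... | no p≰p = contradiction ≤-refl p≰p
... | yes _ with p ≟ p
...   | yes _  = refl
...   | no p≢p = contradiction refl p≢p

entry-[]-≢ : ∀ {p q} → p ≢ q → entry [] p q ≡ -∞
entry-[]-≢ {p} {q} p≢q with p ≤? q
... | no _ = refl
... | yes _ with p ≟ q
...   | yes p≡q = contradiction p≡q p≢q
...   | no _    = refl

φ-[] : ∀ {n} (i j : Fin n) → φ n [] i j ≡ Iᴹ i j
φ-[] i j with toℕ i ≟ toℕ j
... | yes i≡j rewrite i≡j = entry-[]-diag (suc (toℕ j))
... | no i≢j = entry-[]-≢ (λ si≡sj → i≢j (suc-injective si≡sj))

φ-upperTriangular : ∀ {n} (w : Word) → UpperTriangular (φ n w)
φ-upperTriangular w i j j<i = entry-≰ w (λ i≤j → <⇒≱ j<i (s≤s⁻¹ i≤j))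

entry-⊗-≼ : ∀ x u v p c q → (entry (x ∷ u) p c ⊗ entry v c q) ≼ entry (x ∷ u ++ v) p q
-- The case split is an argument, not a `with`: abstracting p ≤? c would also rewrite
-- it inside the `entry` terms of the goal.
entry-⊗-≼ x u v p c q = by-cases (p ≤? c) (c ≤? q)
  where
  by-cases : Dec (p ≤ c) → Dec (c ≤ q) → (entry (x ∷ u) p c ⊗ entry v c q) ≼ entry (x ∷ u ++ v) p q
  by-cases (no p≰c) _ rewrite entry-≰ (x ∷ u) p≰c = -∞≼
  by-cases (yes _)  (no c≰q) rewrite entry-≰ v c≰q | ⊗-zeroʳ (entry (x ∷ u) p c) = -∞≼
  by-cases (yes p≤c) (yes c≤q) rewrite entry-∷ x (u ++ v) (≤-trans p≤c c≤q) =
    ≼-trans (⊗-mono-≼ (entry-≼ (x ∷ u) p c) (entry-≼ v c q))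
            (fin≼ (maxNondecLen-++-≥ (x ∷ u) v p≤c c≤q))

entry-⊗-attained : ∀ x u y v {p q} → p ≤ q →
  Σ[ c ∈ ℕ ] p ≤ c × c ≤ q × entry (x ∷ u ++ y ∷ v) p q ≼ (entry (x ∷ u) p c ⊗ entry (y ∷ v) c q)
entry-⊗-attained x u y v p≤q with maxNondecLen-++-≤ (x ∷ u) (y ∷ v) p≤q
... | c , p≤c , c≤q , bound =
  c , p≤c , c≤q ,
  subst₂ _≼_ (sym (entry-∷ x (u ++ y ∷ v) p≤q))
             (sym (cong₂ _⊗_ (entry-∷ x u p≤c) (entry-∷ y v c≤q)))
             (fin≼ bound)

suc-toℕ-surjective : ∀ {n c} → 1 ≤ c → c ≤ n → Σ[ k ∈ Fin n ] suc (toℕ k) ≡ c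
suc-toℕ-surjective {c = suc _} _ c≤n = fromℕ< c≤n , cong suc (toℕ-fromℕ< c≤n)

φ-∷-++-∷ : ∀ {n} x u y v (i j : Fin n) →
           φ n ((x ∷ u) ++ (y ∷ v)) i j ≡ (φ n (x ∷ u) ⊗ᴹ φ n (y ∷ v)) i j
φ-∷-++-∷ {n} x u y v i j = by-cases (suc (toℕ i) ≤? suc (toℕ j))
  where
  A B : Mat n
  A = φ n (x ∷ u)
  B = φ n (y ∷ v)
  bounded : ∀ k → (A i k ⊗ B k j) ≼ φ n ((x ∷ u) ++ (y ∷ v)) i j
  bounded k = entry-⊗-≼ x u (y ∷ v) (suc (toℕ i)) (suc (toℕ k)) (suc (toℕ j))
  by-cases : Dec (suc (toℕ i) ≤ suc (toℕ j)) → φ n ((x ∷ u) ++ (y ∷ v)) i j ≡ (A ⊗ᴹ B) i j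
  by-cases (no p≰q) =
    sym (⊗ᴹ-≡ A B i j i bounded (≼-trans (≼-reflexive (entry-≰ (x ∷ u ++ y ∷ v) p≰q)) -∞≼))
  by-cases (yes p≤q) with entry-⊗-attained x u y v p≤q
  ... | c , p≤c , c≤q , attained
      with suc-toℕ-surjective (≤-trans (s≤s z≤n) p≤c) (≤-trans c≤q (toℕ<n j))
  ...   | k , refl = sym (⊗ᴹ-≡ A B i j k bounded attained)

lemma5p1 : (n : ℕ) → 1 ≤ n →
    ((w : Word) → UpperTriangular (φ n w))
    × ((i j : Fin n) → φ n [] i j ≡ Iᴹ i j)
    × ((u v : Word) → (i j : Fin n) → φ n (u ++ v) i j ≡ (φ n u ⊗ᴹ φ n v) i j)
lemma5p1 n _ = φ-upperTriangular , φ-[] , φ-++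
  where
  φ-++ : (u v : Word) → (i j : Fin n) → φ n (u ++ v) i j ≡ (φ n u ⊗ᴹ φ n v) i j
  φ-++ []      v       = λ i j → sym (⊗ᴹ-identityˡ (φ n v) φ-[] i j)
  φ-++ (x ∷ u) []      rewrite ++-identityʳ u =
    λ i j → sym (⊗ᴹ-identityʳ (φ n (x ∷ u)) φ-[] i j)
  φ-++ (x ∷ u) (y ∷ v) = φ-∷-++-∷ x u y v
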